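{- In the discrete data-center optimization problem, let $X^\ast=(x^\ast_1,\dots,x^\ast_T)$ be any optimal schedule. Then for all $\tau\in\{1,\dots,T\}$, $x^L_\tau\le x^\ast_\tau\le x^U_\tau$.
   Context: Discrete data-center optimization problem: given $T,m\in\mathbb{N}$, $\beta>0$ and convex functions $f_1,\dots,f_T:\{0,\dots,m\}\to\mathbb{R}_{\ge0}$ (convex meaning $f_t(x+1)-f_t(x)$ nondecreasing), a schedule $X=(x_1,\dots,x_T)\in\{0,\dots,m\}^T$ with $x_0=0$ has cost $\sum_{t=1}^T f_t(x_t)+\beta\sum_{t=1}^T(x_t-x_{t-1})^+$; an optimal schedule minimizes it. For $\tau\in\{1,\dots,T\}$ and $X=(x_1,\dots,x_\tau)\in\{0,\dots,m\}^\tau$ (with $x_0=0$) define $C^L_\tau(X)=\sum_{t=1}^\tau f_t(x_t)+\beta\sum_{t=1}^\tau(x_t-x_{t-1})^+$ and $C^U_\tau(X)=\sum_{t=1}^\tau f_t(x_t)+\beta\sum_{t=1}^\tau(x_{t-1}-x_t)^+$. Let $x^L_\tau$ be the smallest value of the last component $x_\tau$ among all minimizers of $C^L_\tau$, and $x^U_\tau$ the largest value of the last component among all minimizers of $C^U_\tau$.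
   Formalization: The functions $f_t$ and the constant $\beta$ take rational values instead of real ones. -}

module Defs where

open import Data.Nat using (ℕ; zero; suc; _∸_) renaming (_≤_ to _≤ℕ_)
open import Data.Integer using (+_)
open import Data.Rational using (ℚ; _+_; _*_; _-_; _/_; _≤_; 0ℚ)
open import Data.Product using (_×_; Σ)
open import Relation.Binary.PropositionalEquality using (_≡_)

-- A cost instance: f t x is f_t(x) (only meaningful for 1 ≤ t ≤ T, x ≤ m).
-- A schedule is a function X : ℕ → ℕ, with X t = x_t for t ≥ 1; the value X 0
-- is never used (x_0 = 0 is fixed by the definitions below).

ℕ→ℚ : ℕ → ℚ
ℕ→ℚ n = + n / 1

sched : (ℕ → ℕ) → ℕ → ℕ
sched X zero    = 0
sched X (suc t) = X (suc t)

costL : (ℕ → ℕ → ℚ) → ℚ → ℕ → (ℕ → ℕ) → ℚ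
costL f β zero    X = 0ℚ
costL f β (suc t) X =
  costL f β t X + f (suc t) (X (suc t)) + β * ℕ→ℚ (X (suc t) ∸ sched X t)

costU : (ℕ → ℕ → ℚ) → ℚ → ℕ → (ℕ → ℕ) → ℚ
costU f β zero    X = 0ℚ
costU f β (suc t) X =
  costU f β t X + f (suc t) (X (suc t)) + β * ℕ→ℚ (sched X t ∸ X (suc t))

Valid : ℕ → ℕ → (ℕ → ℕ) → Set
Valid m τ X = ∀ t → 1 ≤ℕ t → t ≤ℕ τ → X t ≤ℕ m

Admissible : ℕ → ℕ → (ℕ → ℕ → ℚ) → Set
Admissible T m f =
  ∀ t → 1 ≤ℕ t → t ≤ℕ T →
    (∀ x → x ≤ℕ m → 0ℚ ≤ f t x) ×
    (∀ x → suc (suc x) ≤ℕ m →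
       f t (suc x) - f t x ≤ f t (suc (suc x)) - f t (suc x))

Minimizer : ℕ → ℕ → ((ℕ → ℕ) → ℚ) → (ℕ → ℕ) → Set
Minimizer m τ C X = Valid m τ X × (∀ Y → Valid m τ Y → C X ≤ C Y)

Optimal : ℕ → ℕ → (ℕ → ℕ → ℚ) → ℚ → (ℕ → ℕ) → Set
Optimal T m f β X = Minimizer m T (costL f β T) X

IsLowerBound : ℕ → (ℕ → ℕ → ℚ) → ℚ → ℕ → ℕ → Set
IsLowerBound m f β τ l =
  Σ (ℕ → ℕ) (λ X → Minimizer m τ (costL f β τ) X × X τ ≡ l) ×
  (∀ Y → Minimizer m τ (costL f β τ) Y → l ≤ℕ Y τ)

IsUpperBound : ℕ → (ℕ → ℕ → ℚ) → ℚ → ℕ → ℕ → Set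
IsUpperBound m f β τ u =
  Σ (ℕ → ℕ) (λ X → Minimizer m τ (costU f β τ) X × X τ ≡ u) ×
  (∀ Y → Minimizer m τ (costU f β τ) Y → Y τ ≤ℕ u)

{-# OPTIONS --safe #-}
-- An exchange argument in the lattice of schedules under pointwise max ⊔ₛ and min ⊓ₛ.
-- The prefix costs C^L_τ and C^U_τ are submodular: the f_t-terms are modular and the
-- switching penalties (p, x) ↦ x ∸ p and p ∸ x are submodular on ℕ² (so no hypothesis on
-- the f_t is needed). If X* is optimal and A is any schedule on 1..τ, running A up to τ and
-- X* afterwards changes only the switching cost at τ + 1, by at most β (x*_τ ∸ a_τ). Hence
-- C^L_τ(X*) ≤ C^L_τ(A) when a_τ ≥ x*_τ and, as C^L_τ = C^U_τ + β x_τ, C^U_τ(X*) ≤ C^U_τ(A)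
-- when a_τ ≤ x*_τ. With A = X^L ⊔ X*, submodularity makes X^L ⊓ X* a minimizer of C^L_τ,
-- so x^L_τ ≤ x*_τ; dually X^U ⊔ X* minimizes C^U_τ, so x*_τ ≤ x^U_τ.

module Submission where

open import Defs
open import Data.Nat using (ℕ) renaming (_≤_ to _≤ℕ_)
open import Data.Rational using (ℚ; _<_; 0ℚ)
open import Data.Product using (_×_)

open import Algebra.Bundles using (CommutativeMonoid)
open import Data.Integer.Base as ℤ using ()
import Data.Integer.Properties as ℤ
open import Data.Nat.Base as ℕ using (zero; suc; _∸_; _⊔_; _⊓_; s≤s; z≤n)
import Data.Nat.Properties as ℕ
import Data.Nat.Coprimality as Coprimality
open import Data.Product using (_,_)
open import Data.Rational using (_+_; _*_; _/_; _≤_; -_; mkℚ; nonNegative)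
open import Data.Rational.Properties
open import Data.Sum using (inj₁; inj₂)
open import Function using (_∘_; flip)
open import Relation.Binary.PropositionalEquality
open import Relation.Nullary using (yes; no; contradiction)
open import Algebra.Properties.CommutativeSemigroup (CommutativeMonoid.commutativeSemigroup +-0-commutativeMonoid) using (interchange; xy∙z≈xz∙y; x∙yz≈xz∙y)

private variable
  m n m′ n′ τ T : ℕ
  q : ℚ
  X Y A B : ℕ → ℕ
  C D : (ℕ → ℕ) → ℚ

ℕ→ℚ≡mkℚ : ∀ n → ℕ→ℚ n ≡ mkℚ (ℤ.+ n) 0 (Coprimality.sym (Coprimality.1-coprimeTo n))
ℕ→ℚ≡mkℚ n = normalize-coprime _

ℕ→ℚ-+ : ∀ m n → ℕ→ℚ (m ℕ.+ n) ≡ ℕ→ℚ m + ℕ→ℚ n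
ℕ→ℚ-+ m n rewrite ℕ→ℚ≡mkℚ m | ℕ→ℚ≡mkℚ n =
  cong (_/ 1) (sym (cong₂ ℤ._+_ (ℤ.*-identityʳ (ℤ.+ m)) (ℤ.*-identityʳ (ℤ.+ n))))

ℕ→ℚ-nonNeg : ∀ n → 0ℚ ≤ ℕ→ℚ n
ℕ→ℚ-nonNeg n = nonNegative⁻¹ (ℕ→ℚ n) {{normalize-nonNeg n 1}}

+-cancelʳ-≤ : ∀ r {p q} → p + r ≤ q + r → p ≤ q
+-cancelʳ-≤ r {p} {q} p+r≤q+r = subst₂ _≤_ (p+r-r≡p p) (p+r-r≡p q) (+-monoˡ-≤ (- r) p+r≤q+r)
  where
  p+r-r≡p : ∀ p → p + r + - r ≡ p
  p+r-r≡p p = trans (+-assoc p r (- r)) (trans (cong (p +_) (+-inverseʳ r)) (+-identityʳ p))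

⊔-⊓-modular : ∀ (g : ℕ → ℚ) x y → g (x ⊔ y) + g (x ⊓ y) ≡ g x + g y
⊔-⊓-modular g x y with ℕ.≤-total x y
... | inj₁ x≤y rewrite ℕ.m≤n⇒m⊔n≡n x≤y | ℕ.m≤n⇒m⊓n≡m x≤y = +-comm (g y) (g x)
... | inj₂ y≤x rewrite ℕ.m≥n⇒m⊔n≡m y≤x | ℕ.m≥n⇒m⊓n≡n y≤x = refl

_·ℕ_ : ℚ → ℕ → ℚ
q ·ℕ n = q * ℕ→ℚ n

·ℕ-distrib-+ : ∀ q m n → q ·ℕ (m ℕ.+ n) ≡ q ·ℕ m + q ·ℕ n
·ℕ-distrib-+ q m n = trans (cong (q *_) (ℕ→ℚ-+ m n)) (*-distribˡ-+ q _ _)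

module _ (0≤q : 0ℚ ≤ q) where

  ·ℕ-nonNeg : ∀ n → 0ℚ ≤ q ·ℕ n
  ·ℕ-nonNeg n = subst (_≤ q ·ℕ n) (*-zeroʳ q) (*-monoˡ-≤-nonNeg q {{nonNegative 0≤q}} (ℕ→ℚ-nonNeg n))

  ·ℕ-mono-≤ : m ≤ℕ n → q ·ℕ m ≤ q ·ℕ n
  ·ℕ-mono-≤ {m} {n} m≤n = begin
    q ·ℕ m                 ≡⟨ +-identityʳ (q ·ℕ m) ⟨
    q ·ℕ m + 0ℚ            ≤⟨ +-monoʳ-≤ (q ·ℕ m) (·ℕ-nonNeg (n ∸ m)) ⟩
    q ·ℕ m + q ·ℕ (n ∸ m)  ≡⟨ ·ℕ-distrib-+ q m (n ∸ m) ⟨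
    q ·ℕ (m ℕ.+ (n ∸ m))   ≡⟨ cong (q ·ℕ_) (ℕ.m+[n∸m]≡n m≤n) ⟩
    q ·ℕ n                 ∎
    where open ≤-Reasoning

  ·ℕ-+-mono-≤ : m ℕ.+ n ≤ℕ m′ ℕ.+ n′ → q ·ℕ m + q ·ℕ n ≤ q ·ℕ m′ + q ·ℕ n′
  ·ℕ-+-mono-≤ {m} {n} {m′} {n′} h = subst₂ _≤_ (·ℕ-distrib-+ q m n) (·ℕ-distrib-+ q m′ n′) (·ℕ-mono-≤ h)

∸-triangle : ∀ x y z → x ∸ z ≤ℕ (x ∸ y) ℕ.+ (y ∸ z)
∸-triangle x y z = ℕ.m≤n+o⇒m∸n≤o x z (begin
  x                                ≤⟨ ℕ.m≤n+m∸n x y ⟩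
  y ℕ.+ (x ∸ y)                    ≤⟨ ℕ.+-monoˡ-≤ (x ∸ y) (ℕ.m≤n+m∸n y z) ⟩
  z ℕ.+ (y ∸ z) ℕ.+ (x ∸ y)        ≡⟨ ℕ.+-assoc z (y ∸ z) (x ∸ y) ⟩
  z ℕ.+ ((y ∸ z) ℕ.+ (x ∸ y))      ≡⟨ cong (z ℕ.+_) (ℕ.+-comm (y ∸ z) (x ∸ y)) ⟩
  z ℕ.+ ((x ∸ y) ℕ.+ (y ∸ z))      ∎)
  where open ℕ.≤-Reasoning

∸-monge : ∀ {x y u v} → x ≤ℕ y → u ≤ℕ v → (x ∸ u) ℕ.+ (y ∸ v) ≤ℕ (x ∸ v) ℕ.+ (y ∸ u)
∸-monge {x} {y} {u} {v} x≤y u≤v with ℕ.≤-total x u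
... | inj₁ x≤u = begin
  (x ∸ u) ℕ.+ (y ∸ v)  ≡⟨ cong (ℕ._+ (y ∸ v)) (ℕ.m≤n⇒m∸n≡0 x≤u) ⟩
  y ∸ v                ≤⟨ ℕ.∸-monoʳ-≤ y u≤v ⟩
  y ∸ u                ≤⟨ ℕ.m≤n+m (y ∸ u) (x ∸ v) ⟩
  (x ∸ v) ℕ.+ (y ∸ u)  ∎
  where open ℕ.≤-Reasoning
... | inj₂ u≤x = begin
  (x ∸ u) ℕ.+ (y ∸ v)                ≤⟨ ℕ.+-monoʳ-≤ (x ∸ u) (∸-triangle y x v) ⟩
  (x ∸ u) ℕ.+ ((y ∸ x) ℕ.+ (x ∸ v))  ≡⟨ ℕ.+-assoc (x ∸ u) (y ∸ x) (x ∸ v) ⟨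
  (x ∸ u) ℕ.+ (y ∸ x) ℕ.+ (x ∸ v)    ≡⟨ cong (ℕ._+ (x ∸ v)) (ℕ.+-comm (x ∸ u) (y ∸ x)) ⟩
  (y ∸ x) ℕ.+ (x ∸ u) ℕ.+ (x ∸ v)    ≡⟨ cong (ℕ._+ (x ∸ v)) (ℕ.+-∸-assoc (y ∸ x) u≤x) ⟨
  (y ∸ x) ℕ.+ x ∸ u ℕ.+ (x ∸ v)      ≡⟨ cong (λ w → w ∸ u ℕ.+ (x ∸ v)) (ℕ.m∸n+n≡m x≤y) ⟩
  (y ∸ u) ℕ.+ (x ∸ v)                ≡⟨ ℕ.+-comm (y ∸ u) (x ∸ v) ⟩
  (x ∸ v) ℕ.+ (y ∸ u)                ∎
  where open ℕ.≤-Reasoning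

Submodular₂ : (ℕ → ℕ → ℕ) → Set
Submodular₂ d = ∀ p q x y → d (p ⊔ q) (x ⊔ y) ℕ.+ d (p ⊓ q) (x ⊓ y) ≤ℕ d p x ℕ.+ d q y

∸-submodular : Submodular₂ _∸_
∸-submodular a b a′ b′ with ℕ.≤-total a b | ℕ.≤-total a′ b′
... | inj₁ a≤b | inj₁ a′≤b′
  rewrite ℕ.m≤n⇒m⊔n≡n a≤b | ℕ.m≤n⇒m⊓n≡m a≤b | ℕ.m≤n⇒m⊔n≡n a′≤b′ | ℕ.m≤n⇒m⊓n≡m a′≤b′
  = ℕ.≤-reflexive (ℕ.+-comm (b ∸ b′) (a ∸ a′))
... | inj₁ a≤b | inj₂ b′≤a′
  rewrite ℕ.m≤n⇒m⊔n≡n a≤b | ℕ.m≤n⇒m⊓n≡m a≤b | ℕ.m≥n⇒m⊔n≡m b′≤a′ | ℕ.m≥n⇒m⊓n≡n b′≤a′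
  = ℕ.≤-trans (ℕ.≤-reflexive (ℕ.+-comm (b ∸ a′) (a ∸ b′))) (∸-monge a≤b b′≤a′)
... | inj₂ b≤a | inj₁ a′≤b′
  rewrite ℕ.m≥n⇒m⊔n≡m b≤a | ℕ.m≥n⇒m⊓n≡n b≤a | ℕ.m≤n⇒m⊔n≡n a′≤b′ | ℕ.m≤n⇒m⊓n≡m a′≤b′
  = subst₂ ℕ._≤_ (ℕ.+-comm (b ∸ a′) (a ∸ b′)) (ℕ.+-comm (b ∸ b′) (a ∸ a′)) (∸-monge b≤a a′≤b′)
... | inj₂ b≤a | inj₂ b′≤a′
  rewrite ℕ.m≥n⇒m⊔n≡m b≤a | ℕ.m≥n⇒m⊓n≡n b≤a | ℕ.m≥n⇒m⊔n≡m b′≤a′ | ℕ.m≥n⇒m⊓n≡n b′≤a′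
  = ℕ.≤-refl

m+[n∸m]≡[m∸n]+n : ∀ m n → m ℕ.+ (n ∸ m) ≡ (m ∸ n) ℕ.+ n
m+[n∸m]≡[m∸n]+n m n with ℕ.≤-total m n
... | inj₁ m≤n rewrite ℕ.m≤n⇒m∸n≡0 m≤n = ℕ.m+[n∸m]≡n m≤n
... | inj₂ n≤m rewrite ℕ.m≤n⇒m∸n≡0 n≤m = trans (ℕ.+-identityʳ m) (sym (ℕ.m∸n+n≡m n≤m))

_⊔ₛ_ _⊓ₛ_ : (ℕ → ℕ) → (ℕ → ℕ) → ℕ → ℕ
(X ⊔ₛ Y) t = X t ⊔ Y t
(X ⊓ₛ Y) t = X t ⊓ Y t

sched-⊔ₛ : ∀ X Y t → sched (X ⊔ₛ Y) t ≡ sched X t ⊔ sched Y t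
sched-⊔ₛ X Y zero    = refl
sched-⊔ₛ X Y (suc t) = refl

sched-⊓ₛ : ∀ X Y t → sched (X ⊓ₛ Y) t ≡ sched X t ⊓ sched Y t
sched-⊓ₛ X Y zero    = refl
sched-⊓ₛ X Y (suc t) = refl

sched-cong : ∀ t → X t ≡ Y t → sched X t ≡ sched Y t
sched-cong zero    _      = refl
sched-cong (suc t) Xt≡Yt = Xt≡Yt

splice : ℕ → (ℕ → ℕ) → (ℕ → ℕ) → ℕ → ℕ
splice τ A B t with t ℕ.≤? τ
... | yes _ = A t
... | no  _ = B t

splice-≤ : ∀ {τ t} A B → t ≤ℕ τ → splice τ A B t ≡ A t
splice-≤ {τ} {t} A B t≤τ with t ℕ.≤? τ
... | yes _   = refl
... | no  t≰τ = contradiction t≤τ t≰τ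

splice-> : ∀ {τ t} A B → τ ℕ.< t → splice τ A B t ≡ B t
splice-> {τ} {t} A B τ<t with t ℕ.≤? τ
... | yes t≤τ = contradiction t≤τ (ℕ.<⇒≱ τ<t)
... | no  _   = refl

Valid-prefix : τ ≤ℕ T → Valid m T X → Valid m τ X
Valid-prefix τ≤T valid-X t 1≤t t≤τ = valid-X t 1≤t (ℕ.≤-trans t≤τ τ≤T)

Valid-⊔ₛ : Valid m τ X → Valid m τ Y → Valid m τ (X ⊔ₛ Y)
Valid-⊔ₛ valid-X valid-Y t 1≤t t≤τ = ℕ.⊔-lub (valid-X t 1≤t t≤τ) (valid-Y t 1≤t t≤τ)

Valid-⊓ₛ : Valid m τ X → Valid m τ (X ⊓ₛ Y)
Valid-⊓ₛ {X = X} {Y = Y} valid-X t 1≤t t≤τ = ℕ.≤-trans (ℕ.m⊓n≤m (X t) (Y t)) (valid-X t 1≤t t≤τ)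

Valid-splice : Valid m τ A → Valid m T B → Valid m T (splice τ A B)
Valid-splice {τ = τ} valid-A valid-B t 1≤t t≤T with t ℕ.≤? τ
... | yes t≤τ = valid-A t 1≤t t≤τ
... | no  _   = valid-B t 1≤t t≤T

Submodular : ((ℕ → ℕ) → ℚ) → Set
Submodular C = ∀ X Y → C (X ⊔ₛ Y) + C (X ⊓ₛ Y) ≤ C X + C Y

Submodular-resp : (∀ X → C X ≡ D X) → Submodular D → Submodular C
Submodular-resp C≡D D-submodular X Y =
  subst₂ _≤_ (sym (cong₂ _+_ (C≡D (X ⊔ₛ Y)) (C≡D (X ⊓ₛ Y)))) (sym (cong₂ _+_ (C≡D X) (C≡D Y))) (D-submodular X Y)

Submodular-+ : Submodular C → Submodular D → Submodular (λ X → C X + D X)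
Submodular-+ {C} {D} C-submodular D-submodular X Y =
  subst₂ _≤_ (interchange (C (X ⊔ₛ Y)) (C (X ⊓ₛ Y)) (D (X ⊔ₛ Y)) (D (X ⊓ₛ Y)))
             (interchange (C X) (C Y) (D X) (D Y))
             (+-mono-≤ (C-submodular X Y) (D-submodular X Y))

module _ (C-submodular : Submodular C) where

  Minimizer-⊓ₛ : Minimizer m τ C X → C Y ≤ C (X ⊔ₛ Y) → Minimizer m τ C (X ⊓ₛ Y)
  Minimizer-⊓ₛ {X = X} {Y = Y} (valid-X , X-min) CY≤C[X⊔Y] =
    Valid-⊓ₛ valid-X , λ Z valid-Z → ≤-trans C[X⊓Y]≤CX (X-min Z valid-Z)
    where
    open ≤-Reasoning
    C[X⊓Y]≤CX : C (X ⊓ₛ Y) ≤ C X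
    C[X⊓Y]≤CX = +-cancelʳ-≤ (C (X ⊔ₛ Y)) (begin
      C (X ⊓ₛ Y) + C (X ⊔ₛ Y)  ≡⟨ +-comm (C (X ⊓ₛ Y)) (C (X ⊔ₛ Y)) ⟩
      C (X ⊔ₛ Y) + C (X ⊓ₛ Y)  ≤⟨ C-submodular X Y ⟩
      C X + C Y                ≤⟨ +-monoʳ-≤ (C X) CY≤C[X⊔Y] ⟩
      C X + C (X ⊔ₛ Y)         ∎)

  Minimizer-⊔ₛ : Minimizer m τ C X → Valid m τ Y → C Y ≤ C (X ⊓ₛ Y) → Minimizer m τ C (X ⊔ₛ Y)
  Minimizer-⊔ₛ {X = X} {Y = Y} (valid-X , X-min) valid-Y CY≤C[X⊓Y] =
    Valid-⊔ₛ valid-X valid-Y , λ Z valid-Z → ≤-trans C[X⊔Y]≤CX (X-min Z valid-Z)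
    where
    C[X⊔Y]≤CX : C (X ⊔ₛ Y) ≤ C X
    C[X⊔Y]≤CX = +-cancelʳ-≤ (C (X ⊓ₛ Y))
      (≤-trans (C-submodular X Y) (+-monoʳ-≤ (C X) CY≤C[X⊓Y]))

module Costs (f : ℕ → ℕ → ℚ) {β : ℚ} (0≤β : 0ℚ ≤ β) where

  step : (ℕ → ℕ → ℕ) → ℕ → (ℕ → ℕ) → ℚ
  step d t X = f (suc t) (X (suc t)) + β ·ℕ d (sched X t) (X (suc t))

  cost : (ℕ → ℕ → ℕ) → ℕ → (ℕ → ℕ) → ℚ
  cost d zero    X = 0ℚ
  cost d (suc t) X = cost d t X + step d t X

  stepL : ℕ → (ℕ → ℕ) → ℚ
  stepL = step (flip _∸_)

  costL≡cost : ∀ τ X → costL f β τ X ≡ cost (flip _∸_) τ X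
  costL≡cost zero    X = refl
  costL≡cost (suc τ) X =
    trans (+-assoc (costL f β τ X) _ _) (cong (_+ stepL τ X) (costL≡cost τ X))

  costU≡cost : ∀ τ X → costU f β τ X ≡ cost _∸_ τ X
  costU≡cost zero    X = refl
  costU≡cost (suc τ) X =
    trans (+-assoc (costU f β τ X) _ _) (cong (_+ step _∸_ τ X) (costU≡cost τ X))

  step-cong : ∀ d t {X Y} → X (suc t) ≡ Y (suc t) → sched X t ≡ sched Y t → step d t X ≡ step d t Y
  step-cong d t x≡y p≡q = cong₂ (λ x p → f (suc t) x + β ·ℕ d p x) x≡y p≡q

  cost-cong : ∀ d τ → (∀ {t} → t ≤ℕ τ → X t ≡ Y t) → cost d τ X ≡ cost d τ Y
  cost-cong d zero    X≡Y = refl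
  cost-cong d (suc τ) X≡Y = cong₂ _+_ (cost-cong d τ (X≡Y ∘ ℕ.m≤n⇒m≤1+n))
    (step-cong d τ (X≡Y ℕ.≤-refl) (sched-cong τ (X≡Y (ℕ.n≤1+n τ))))

  costL-cong : ∀ τ → (∀ {t} → t ≤ℕ τ → X t ≡ Y t) → costL f β τ X ≡ costL f β τ Y
  costL-cong τ X≡Y =
    trans (costL≡cost τ _) (trans (cost-cong (flip _∸_) τ X≡Y) (sym (costL≡cost τ _)))

  switching-submodular : ∀ d → Submodular₂ d → ∀ t → Submodular (λ X → β ·ℕ d (sched X t) (X (suc t)))
  switching-submodular d d-submodular t X Y rewrite sched-⊔ₛ X Y t | sched-⊓ₛ X Y t =
    ·ℕ-+-mono-≤ 0≤β {d (p ⊔ p′) (x ⊔ x′)} {d (p ⊓ p′) (x ⊓ x′)} {d p x} {d p′ x′}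
      (d-submodular p p′ x x′)
    where
    p = sched X t
    p′ = sched Y t
    x = X (suc t)
    x′ = Y (suc t)

  step-submodular : ∀ d → Submodular₂ d → ∀ t → Submodular (step d t)
  step-submodular d d-submodular t =
    Submodular-+ {λ X → f (suc t) (X (suc t))} {λ X → β ·ℕ d (sched X t) (X (suc t))}
      (λ X Y → ≤-reflexive (⊔-⊓-modular (f (suc t)) (X (suc t)) (Y (suc t))))
      (switching-submodular d d-submodular t)

  cost-submodular : ∀ d → Submodular₂ d → ∀ τ → Submodular (cost d τ)
  cost-submodular d d-submodular zero    X Y = ≤-refl
  cost-submodular d d-submodular (suc τ) =
    Submodular-+ {cost d τ} {step d τ}
      (cost-submodular d d-submodular τ) (step-submodular d d-submodular τ)

  costL-submodular : ∀ τ → Submodular (costL f β τ)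
  costL-submodular τ = Submodular-resp (costL≡cost τ)
    (cost-submodular (flip _∸_) (λ p q x y → ∸-submodular x y p q) τ)

  costU-submodular : ∀ τ → Submodular (costU f β τ)
  costU-submodular τ = Submodular-resp (costU≡cost τ) (cost-submodular _∸_ ∸-submodular τ)

  costL≡costU+β·last : ∀ τ X → costL f β τ X ≡ costU f β τ X + β ·ℕ sched X τ
  costL≡costU+β·last zero    X = sym (trans (+-identityˡ (β * 0ℚ)) (*-zeroʳ β))
  costL≡costU+β·last (suc τ) X = begin
    costL f β τ X + F + β ·ℕ (x ∸ p)    ≡⟨ cong (λ c → c + F + β ·ℕ (x ∸ p)) (costL≡costU+β·last τ X) ⟩
    U + β ·ℕ p + F + β ·ℕ (x ∸ p)       ≡⟨ +-assoc (U + β ·ℕ p) F (β ·ℕ (x ∸ p)) ⟩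
    (U + β ·ℕ p) + (F + β ·ℕ (x ∸ p))   ≡⟨ interchange U (β ·ℕ p) F (β ·ℕ (x ∸ p)) ⟩
    (U + F) + (β ·ℕ p + β ·ℕ (x ∸ p))   ≡⟨ cong (U + F +_) β·p+β·[x∸p]≡β·[p∸x]+β·x ⟩
    (U + F) + (β ·ℕ (p ∸ x) + β ·ℕ x)   ≡⟨ +-assoc (U + F) (β ·ℕ (p ∸ x)) (β ·ℕ x) ⟨
    U + F + β ·ℕ (p ∸ x) + β ·ℕ x       ∎
    where
    open ≡-Reasoning
    U = costU f β τ X
    F = f (suc τ) (X (suc τ))
    x = X (suc τ)
    p = sched X τ
    β·p+β·[x∸p]≡β·[p∸x]+β·x : β ·ℕ p + β ·ℕ (x ∸ p) ≡ β ·ℕ (p ∸ x) + β ·ℕ x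
    β·p+β·[x∸p]≡β·[p∸x]+β·x = begin
      β ·ℕ p + β ·ℕ (x ∸ p)   ≡⟨ ·ℕ-distrib-+ β p (x ∸ p) ⟨
      β ·ℕ (p ℕ.+ (x ∸ p))    ≡⟨ cong (β ·ℕ_) (m+[n∸m]≡[m∸n]+n p x) ⟩
      β ·ℕ ((p ∸ x) ℕ.+ x)    ≡⟨ ·ℕ-distrib-+ β (p ∸ x) x ⟩
      β ·ℕ (p ∸ x) + β ·ℕ x   ∎

  tailCostL : ℕ → ℕ → (ℕ → ℕ) → ℚ
  tailCostL τ zero    X = 0ℚ
  tailCostL τ (suc k) X = tailCostL τ k X + stepL (k ℕ.+ τ) X

  costL-split : ∀ τ k X → costL f β (k ℕ.+ τ) X ≡ costL f β τ X + tailCostL τ k X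
  costL-split τ zero    X = sym (+-identityʳ (costL f β τ X))
  costL-split τ (suc k) X = begin
    costL f β (k ℕ.+ τ) X + F + S                   ≡⟨ +-assoc (costL f β (k ℕ.+ τ) X) F S ⟩
    costL f β (k ℕ.+ τ) X + (F + S)                 ≡⟨ cong (_+ (F + S)) (costL-split τ k X) ⟩
    costL f β τ X + tailCostL τ k X + (F + S)       ≡⟨ +-assoc (costL f β τ X) (tailCostL τ k X) (F + S) ⟩
    costL f β τ X + (tailCostL τ k X + (F + S))     ∎
    where
    open ≡-Reasoning
    F = f (suc (k ℕ.+ τ)) (X (suc (k ℕ.+ τ)))
    S = β ·ℕ (X (suc (k ℕ.+ τ)) ∸ sched X (k ℕ.+ τ))

  stepL-≤-gap : ∀ t {Z X} → Z (suc t) ≡ X (suc t) →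
               stepL t Z ≤ stepL t X + β ·ℕ (sched X t ∸ sched Z t)
  stepL-≤-gap t {Z} {X} Z≡X rewrite Z≡X = begin
    F + β ·ℕ (x ∸ z)                        ≤⟨ +-monoʳ-≤ F (·ℕ-mono-≤ 0≤β (∸-triangle x y z)) ⟩
    F + β ·ℕ ((x ∸ y) ℕ.+ (y ∸ z))          ≡⟨ cong (F +_) (·ℕ-distrib-+ β (x ∸ y) (y ∸ z)) ⟩
    F + (β ·ℕ (x ∸ y) + β ·ℕ (y ∸ z))       ≡⟨ +-assoc F (β ·ℕ (x ∸ y)) (β ·ℕ (y ∸ z)) ⟨
    F + β ·ℕ (x ∸ y) + β ·ℕ (y ∸ z)         ∎
    where
    open ≤-Reasoning
    F = f (suc t) (X (suc t))
    x = X (suc t)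
    y = sched X t
    z = sched Z t

  tailCostL-≤ : ∀ τ {Z X} → (∀ {t} → τ ℕ.< t → Z t ≡ X t) → ∀ k →
                tailCostL τ k Z ≤ tailCostL τ k X + β ·ℕ (sched X τ ∸ sched Z τ)
  tailCostL-≤ τ {Z} {X} Z≡X zero =
    subst (_ ≤_) (sym (+-identityˡ _)) (·ℕ-nonNeg 0≤β (sched X τ ∸ sched Z τ))
  tailCostL-≤ τ {Z} {X} Z≡X (suc zero) = begin
    0ℚ + stepL τ Z        ≡⟨ +-identityˡ (stepL τ Z) ⟩
    stepL τ Z             ≤⟨ stepL-≤-gap τ {Z} {X} (Z≡X ℕ.≤-refl) ⟩
    stepL τ X + gap       ≡⟨ cong (_+ gap) (+-identityˡ (stepL τ X)) ⟨
    0ℚ + stepL τ X + gap  ∎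
    where
    open ≤-Reasoning
    gap = β ·ℕ (sched X τ ∸ sched Z τ)
  tailCostL-≤ τ {Z} {X} Z≡X (suc (suc k)) = begin
    tailCostL τ (suc k) Z + stepL t Z        ≡⟨ cong (tailCostL τ (suc k) Z +_) stepL-Z≡stepL-X ⟩
    tailCostL τ (suc k) Z + stepL t X        ≤⟨ +-monoˡ-≤ (stepL t X) (tailCostL-≤ τ Z≡X (suc k)) ⟩
    tailCostL τ (suc k) X + gap + stepL t X  ≡⟨ xy∙z≈xz∙y (tailCostL τ (suc k) X) gap (stepL t X) ⟩
    tailCostL τ (suc k) X + stepL t X + gap  ∎
    where
    open ≤-Reasoning
    t = suc k ℕ.+ τ
    gap = β ·ℕ (sched X τ ∸ sched Z τ)
    stepL-Z≡stepL-X : stepL t Z ≡ stepL t X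
    stepL-Z≡stepL-X =
      step-cong (flip _∸_) t {Z} {X} (Z≡X (s≤s (ℕ.m≤n+m τ (suc k)))) (Z≡X (s≤s (ℕ.m≤n+m τ k)))

  optimal-prefix-≤ : Optimal T m f β X → τ ≤ℕ T → Valid m τ A →
                     costL f β τ X ≤ costL f β τ A + β ·ℕ (sched X τ ∸ sched A τ)
  optimal-prefix-≤ {T} {m} {X} {τ} {A} (valid-X , X-optimal) τ≤T valid-A
    with T ∸ τ | ℕ.m∸n+n≡m τ≤T
  ... | k | refl = +-cancelʳ-≤ (tail X) (begin
    costL f β τ X + tail X            ≡⟨ costL-split τ k X ⟨
    costL f β (k ℕ.+ τ) X             ≤⟨ X-optimal Z (Valid-splice valid-A valid-X) ⟩
    costL f β (k ℕ.+ τ) Z             ≡⟨ costL-split τ k Z ⟩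
    costL f β τ Z + tail Z            ≡⟨ cong (_+ tail Z) (costL-cong τ (splice-≤ A X)) ⟩
    costL f β τ A + tail Z            ≤⟨ +-monoʳ-≤ (costL f β τ A) (tailCostL-≤ τ (splice-> A X) k) ⟩
    costL f β τ A + (tail X + gap Z)  ≡⟨ cong (λ g → costL f β τ A + (tail X + g)) gap-Z≡gap-A ⟩
    costL f β τ A + (tail X + gap A)  ≡⟨ x∙yz≈xz∙y (costL f β τ A) (tail X) (gap A) ⟩
    costL f β τ A + gap A + tail X    ∎)
    where
    open ≤-Reasoning
    Z = splice τ A X
    tail : (ℕ → ℕ) → ℚ
    tail = tailCostL τ k
    gap : (ℕ → ℕ) → ℚ
    gap W = β ·ℕ (sched X τ ∸ sched W τ)
    gap-Z≡gap-A : gap Z ≡ gap A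
    gap-Z≡gap-A = cong (λ w → β ·ℕ (sched X τ ∸ w)) (sched-cong τ (splice-≤ A X ℕ.≤-refl))

  optimal-costL-prefix : Optimal T m f β X → τ ≤ℕ T → Valid m τ A → sched X τ ≤ℕ sched A τ →
                         costL f β τ X ≤ costL f β τ A
  optimal-costL-prefix {X = X} {τ = τ} {A = A} X-optimal τ≤T valid-A x≤a = begin
    costL f β τ X                                 ≤⟨ optimal-prefix-≤ X-optimal τ≤T valid-A ⟩
    costL f β τ A + β ·ℕ (sched X τ ∸ sched A τ)  ≡⟨ cong (λ g → costL f β τ A + β ·ℕ g) (ℕ.m≤n⇒m∸n≡0 x≤a) ⟩
    costL f β τ A + β * 0ℚ                        ≡⟨ cong (costL f β τ A +_) (*-zeroʳ β) ⟩
    costL f β τ A + 0ℚ                            ≡⟨ +-identityʳ (costL f β τ A) ⟩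
    costL f β τ A                                 ∎
    where open ≤-Reasoning

  optimal-costU-prefix : Optimal T m f β X → τ ≤ℕ T → Valid m τ A → sched A τ ≤ℕ sched X τ →
                         costU f β τ X ≤ costU f β τ A
  optimal-costU-prefix {X = X} {τ = τ} {A = A} X-optimal τ≤T valid-A a≤x = +-cancelʳ-≤ (β ·ℕ x) (begin
    costU f β τ X + β ·ℕ x                   ≡⟨ costL≡costU+β·last τ X ⟨
    costL f β τ X                            ≤⟨ optimal-prefix-≤ X-optimal τ≤T valid-A ⟩
    costL f β τ A + β ·ℕ (x ∸ a)             ≡⟨ cong (_+ β ·ℕ (x ∸ a)) (costL≡costU+β·last τ A) ⟩
    costU f β τ A + β ·ℕ a + β ·ℕ (x ∸ a)    ≡⟨ +-assoc (costU f β τ A) (β ·ℕ a) (β ·ℕ (x ∸ a)) ⟩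
    costU f β τ A + (β ·ℕ a + β ·ℕ (x ∸ a))  ≡⟨ cong (costU f β τ A +_) (·ℕ-distrib-+ β a (x ∸ a)) ⟨
    costU f β τ A + β ·ℕ (a ℕ.+ (x ∸ a))     ≡⟨ cong (λ y → costU f β τ A + β ·ℕ y) (ℕ.m+[n∸m]≡n a≤x) ⟩
    costU f β τ A + β ·ℕ x                   ∎)
    where
    open ≤-Reasoning
    x = sched X τ
    a = sched A τ

lemma3p1 : (T m : ℕ) (β : ℚ) (f : ℕ → ℕ → ℚ) →
    0ℚ < β → Admissible T m f →
    (Xs : ℕ → ℕ) → Optimal T m f β Xs →
    ∀ τ → 1 ≤ℕ τ → τ ≤ℕ T →
    ∀ l u → IsLowerBound m f β τ l → IsUpperBound m f β τ u →
    l ≤ℕ Xs τ × Xs τ ≤ℕ u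
lemma3p1 T m β f 0<β _ Xs Xs-optimal@(valid-Xs , _) τ@(suc _) (s≤s z≤n) τ≤T l u
  ((XL , XL-minimizer@(valid-XL , _) , _) , l-least)
  ((XU , XU-minimizer@(valid-XU , _) , _) , u-greatest) =
  ℕ.≤-trans (l-least (XL ⊓ₛ Xs) XL⊓Xs-minimizer) (ℕ.m⊓n≤n (XL τ) (Xs τ)) ,
  ℕ.≤-trans (ℕ.m≤n⊔m (XU τ) (Xs τ)) (u-greatest (XU ⊔ₛ Xs) XU⊔Xs-minimizer)
  where
  open Costs f (<⇒≤ 0<β)
  valid-Xs-τ : Valid m τ Xs
  valid-Xs-τ = Valid-prefix τ≤T valid-Xs
  XL⊓Xs-minimizer : Minimizer m τ (costL f β τ) (XL ⊓ₛ Xs)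
  XL⊓Xs-minimizer = Minimizer-⊓ₛ (costL-submodular τ) XL-minimizer
    (optimal-costL-prefix Xs-optimal τ≤T (Valid-⊔ₛ valid-XL valid-Xs-τ) (ℕ.m≤n⊔m (XL τ) (Xs τ)))
  XU⊔Xs-minimizer : Minimizer m τ (costU f β τ) (XU ⊔ₛ Xs)
  XU⊔Xs-minimizer = Minimizer-⊔ₛ (costU-submodular τ) XU-minimizer valid-Xs-τ
    (optimal-costU-prefix Xs-optimal τ≤T (Valid-⊓ₛ valid-XU) (ℕ.m⊓n≤n (XU τ) (Xs τ)))
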